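{- Let $T$ be a tree. An edge of $T$ is $\alpha_3$-critical if and only if it is $\mu_3$-critical.
   Context: A dissociation set of a graph $G$ is a set $S$ of vertices such that $G[S]$ has maximum degree at most $1$, and $\alpha_3(G)$ is the maximum cardinality of a dissociation set. A $3$-path is a (not necessarily induced) subgraph isomorphic to the path on $3$ vertices; a $3$-matching is a set of pairwise vertex-disjoint $3$-paths, and $\mu_3(G)$ is the maximum number of paths in a $3$-matching. An edge $e$ is $\alpha_3$-critical if $\alpha_3(G-e)>\alpha_3(G)$ and $\mu_3$-critical if $\mu_3(G-e)<\mu_3(G)$, where $G-e$ is obtained by deleting the edge $e$. -}

module Defs where

open import Data.Nat using (ℕ; _<_; _≤_)
open import Data.Fin using (Fin; _≟_)
open import Data.Bool using (Bool; true; false; _∧_; not; _∨_)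
open import Data.Product using (_×_; _,_; ∃; Σ)
open import Data.List using (List; []; _∷_; length; concatMap)
open import Data.List.Relation.Unary.Unique.Propositional using (Unique)
open import Data.List.Relation.Unary.All using (All)
open import Data.Fin.Subset using (Subset; _∈_; ∣_∣)
open import Relation.Binary.PropositionalEquality using (_≡_)
open import Relation.Nullary.Decidable using (⌊_⌋)
open import Relation.Nullary using (¬_)

record Graph (n : ℕ) : Set where
  field
    adj    : Fin n → Fin n → Bool
    sym    : ∀ x y → adj x y ≡ adj y x
    irrefl : ∀ x → adj x x ≡ false
open Graph public

Adj : ∀ {n} → Graph n → Fin n → Fin n → Set
Adj G x y = adj G x y ≡ true

samePair : ∀ {n} → Fin n → Fin n → Fin n → Fin n → Bool
samePair u v x y = (⌊ x ≟ u ⌋ ∧ ⌊ y ≟ v ⌋) ∨ (⌊ x ≟ v ⌋ ∧ ⌊ y ≟ u ⌋)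

deleteEdge : ∀ {n} → Graph n → Fin n → Fin n → Graph n
deleteEdge {n} G u v = record
  { adj = λ x y → adj G x y ∧ not (samePair u v x y)
  ; sym = symP
  ; irrefl = irr
  }
  where
  open import Data.Bool.Properties using (∨-comm)
  open import Relation.Binary.PropositionalEquality using (cong₂; cong; refl)
  open import Data.Bool.Properties using (∧-comm)
  sp : ∀ x y → samePair u v x y ≡ samePair u v y x
  sp x y with x ≟ u | y ≟ v | x ≟ v | y ≟ u
  ... | a | b | c | d =
        Relation.Binary.PropositionalEquality.trans
          (∨-comm (⌊ a ⌋ ∧ ⌊ b ⌋) (⌊ c ⌋ ∧ ⌊ d ⌋))
          (cong₂ _∨_ (∧-comm ⌊ c ⌋ ⌊ d ⌋) (∧-comm ⌊ a ⌋ ⌊ b ⌋))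
  symP : ∀ x y → (adj G x y ∧ not (samePair u v x y)) ≡ (adj G y x ∧ not (samePair u v y x))
  symP x y = cong₂ (λ p q → p ∧ not q) (Graph.sym G x y) (sp x y)
  irr : ∀ x → (adj G x x ∧ not (samePair u v x x)) ≡ false
  irr x rewrite Graph.irrefl G x = refl

data Reach {n} (G : Graph n) : Fin n → Fin n → Set where
  here : ∀ {x} → Reach G x x
  step : ∀ {x y z} → Adj G x y → Reach G y z → Reach G x z

Connected : ∀ {n} → Graph n → Set
Connected G = ∀ x y → Reach G x y

data Walk {n} (G : Graph n) : Fin n → List (Fin n) → Fin n → Set where
  one  : ∀ {x} → Walk G x (x ∷ []) x
  cons : ∀ {x y z vs} → Adj G x y → Walk G y vs z → Walk G x (x ∷ vs) z

HasCycle : ∀ {n} → Graph n → Set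
HasCycle {n} G = Σ (Fin n) λ x → Σ (Fin n) λ y → Σ (List (Fin n)) λ vs →
  Walk G x vs y × Unique vs × (2 < length vs) × Adj G y x

Acyclic : ∀ {n} → Graph n → Set
Acyclic G = ¬ HasCycle G

IsTree : ∀ {n} → Graph n → Set
IsTree G = Connected G × Acyclic G

-- Dissociation set: induced subgraph G[S] has maximum degree ≤ 1, i.e. every
-- vertex of S has at most one neighbour in S.
IsDissociation : ∀ {n} → Graph n → Subset n → Set
IsDissociation G S = ∀ v a b → v ∈ S → a ∈ S → b ∈ S →
  Adj G v a → Adj G v b → a ≡ b

-- α₃(G - e) > α₃(G): some dissociation set of G - e is strictly larger than
-- every dissociation set of G.
α₃-critical : ∀ {n} → Graph n → Fin n → Fin n → Set
α₃-critical {n} G u v = Σ (Subset n) λ S → IsDissociation (deleteEdge G u v) S ×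
  (∀ S′ → IsDissociation G S′ → ∣ S′ ∣ < ∣ S ∣)

Is3Path : ∀ {n} → Graph n → Fin n × Fin n × Fin n → Set
Is3Path G (a , b , c) = Adj G a b × Adj G b c

vertices : ∀ {n} → List (Fin n × Fin n × Fin n) → List (Fin n)
vertices = concatMap (λ { (a , b , c) → a ∷ b ∷ c ∷ [] })

-- 3-matching: list of 3-paths whose vertices are all pairwise distinct
-- (so the paths are genuine P₃'s and pairwise vertex-disjoint).
Is3Matching : ∀ {n} → Graph n → List (Fin n × Fin n × Fin n) → Set
Is3Matching G M = All (Is3Path G) M × Unique (vertices M)

-- μ₃(G - e) < μ₃(G): some 3-matching of G is strictly larger than every
-- 3-matching of G - e.
μ₃-critical : ∀ {n} → Graph n → Fin n → Fin n → Set
μ₃-critical {n} G u v = Σ (List (Fin n × Fin n × Fin n)) λ M → Is3Matching G M ×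
  (∀ M′ → Is3Matching (deleteEdge G u v) M′ → length M′ < length M)

-- Every 3-path of a 3-matching contains a vertex outside a given dissociation
-- set, and these vertices are distinct, so α₃(G) + μ₃(G) ≤ n for every graph.
-- In a forest equality holds, by induction on the vertex set: either some
-- vertex lies on no 3-path, and it joins the dissociation set; or, at the far
-- end of a longest path through centres of 3-paths, there is a 3-path that is
-- cut off from all others by deleting one of its vertices, and it joins the
-- matching. As T − e is again a forest on the same vertices,
-- α₃(T − e) − α₃(T) = μ₃(T) − μ₃(T − e).
module Submission where

open import Defs
open import Data.Nat using (ℕ; zero; suc; _+_; _≤_; _<_; z≤n; s≤s)
open import Data.Nat.Properties using (+-suc; +-identityʳ; +-comm; n≮n; +-cancelˡ-<; +-monoˡ-<; ≤-trans; ≤-reflexive; module ≤-Reasoning)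
open import Data.Fin using (Fin; zero; suc; _≟_)
open import Data.Fin.Properties using (any?)
open import Data.Fin.Subset using (Subset; _∈_; _∉_; _⊆_; _⊂_; ∣_∣; ⁅_⁆; _∪_; _-_; inside; outside) renaming (⊥ to ∅; ⊤ to full)
open import Data.Fin.Subset.Properties using (_∈?_; ∣p∣≤n; ∣⊥∣≡0; ∣⊤∣≡n; ∉⊥; nonempty?; Empty-unique; p─⊥≡p; ∪-identityʳ; x∈⁅y⁆⇒x≡y; x∈p∪q⁻; p─q⊆p; ⊆-min; ⊆-trans; x∈p⇒p-x⊂p)
open import Data.Fin.Subset.Induction using (Acc; acc; ⊂-wellFounded)
open import Data.Bool using (true; false) renaming (_≟_ to _≟ᵇ_)
open import Data.Vec using (_∷_; here; there)
open import Data.List using (List; []; _∷_; _++_; length)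
open import Data.List.Relation.Unary.All as All using (All; []; _∷_)
open import Data.List.Relation.Unary.All.Properties using (anti-mono; ¬Any⇒All¬; ++⁻ʳ)
open import Data.List.Relation.Unary.Any using (here; there)
open import Data.List.Relation.Unary.AllPairs using ([]; _∷_)
open import Data.List.Relation.Unary.Unique.Propositional using (Unique)
open import Data.List.Relation.Unary.Unique.Propositional.Properties using (drop⁺)
open import Data.List.Membership.Propositional using () renaming (_∈_ to _∈ₗ_)
open import Data.List.Membership.Propositional.Properties using (∈-++⁺ˡ; ∈-++⁺ʳ)
open import Data.List.Relation.Binary.Subset.Propositional using () renaming (_⊆_ to _⊆ₗ_)
open import Data.Product using (Σ-syntax; _×_; _,_; proj₁; proj₂)
open import Data.Sum using (_⊎_; inj₁; inj₂)
import Data.Sum as Sum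
open import Data.Empty using (⊥-elim)
open import Function using (_∘_)
open import Function.Bundles using (_⇔_; mk⇔)
open import Relation.Binary.PropositionalEquality as ≡ using (_≡_; _≢_; refl; cong; subst)
open import Relation.Nullary using (Dec; yes; no; ¬_)
open import Relation.Nullary.Decidable using (_×-dec_; _⊎-dec_; ¬?)

private
  variable
    n : ℕ

x∉p-x : (p : Subset n) (x : Fin n) → x ∉ p - x
x∉p-x (s ∷ p) zero ()
x∉p-x (s ∷ p) (suc x) (there x∈) = x∉p-x p x x∈

suc∣p-x∣≡∣p∣ : {p : Subset n} {x : Fin n} → x ∈ p → suc ∣ p - x ∣ ≡ ∣ p ∣
suc∣p-x∣≡∣p∣ {p = inside  ∷ p} here = cong (suc ∘ ∣_∣) (p─⊥≡p p)
suc∣p-x∣≡∣p∣ {p = inside  ∷ p} (there x∈p) = cong suc (suc∣p-x∣≡∣p∣ x∈p)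
suc∣p-x∣≡∣p∣ {p = outside ∷ p} (there x∈p) = suc∣p-x∣≡∣p∣ x∈p

∣p∪⁅x⁆∣≡suc∣p∣ : {p : Subset n} {x : Fin n} → x ∉ p → ∣ p ∪ ⁅ x ⁆ ∣ ≡ suc ∣ p ∣
∣p∪⁅x⁆∣≡suc∣p∣ {p = inside  ∷ p} {zero}  x∉p = ⊥-elim (x∉p here)
∣p∪⁅x⁆∣≡suc∣p∣ {p = outside ∷ p} {zero}  _   = cong (suc ∘ ∣_∣) (∪-identityʳ p)
∣p∪⁅x⁆∣≡suc∣p∣ {p = inside  ∷ p} {suc x} x∉p = cong suc (∣p∪⁅x⁆∣≡suc∣p∣ (x∉p ∘ there))
∣p∪⁅x⁆∣≡suc∣p∣ {p = outside ∷ p} {suc x} x∉p = ∣p∪⁅x⁆∣≡suc∣p∣ (x∉p ∘ there)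

x∈p∪⁅y⁆⁻ : {p : Subset n} {x y : Fin n} → x ∈ p ∪ ⁅ y ⁆ → x ∈ p ⊎ x ≡ y
x∈p∪⁅y⁆⁻ {p = p} {y = y} = Sum.map₂ (x∈⁅y⁆⇒x≡y y) ∘ x∈p∪q⁻ p ⁅ y ⁆

p∪⁅x⁆⊆q : {p q : Subset n} {x : Fin n} → p ⊆ q → x ∈ q → p ∪ ⁅ x ⁆ ⊆ q
p∪⁅x⁆⊆q p⊆q x∈q y∈ with x∈p∪⁅y⁆⁻ y∈
... | inj₁ y∈p  = p⊆q y∈p
... | inj₂ refl = x∈q

x∉p∪⁅y⁆ : {p : Subset n} {x y : Fin n} → x ∉ p → x ≢ y → x ∉ p ∪ ⁅ y ⁆
x∉p∪⁅y⁆ x∉p x≢y x∈ = Sum.[ x∉p , x≢y ]′ (x∈p∪⁅y⁆⁻ x∈)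

∣p∣+length≤n : (p : Subset n) {xs : List (Fin n)} → All (_∉ p) xs → Unique xs → ∣ p ∣ + length xs ≤ n
∣p∣+length≤n {n} p [] [] = subst (_≤ n) (≡.sym (+-identityʳ ∣ p ∣)) (∣p∣≤n p)
∣p∣+length≤n {n} p {x ∷ xs} (x∉p ∷ xs∉p) (x∉xs ∷ xs-unique) =
  subst (_≤ n) count (∣p∣+length≤n (p ∪ ⁅ x ⁆) xs∉p∪⁅x⁆ xs-unique)
  where
  xs∉p∪⁅x⁆ : All (_∉ p ∪ ⁅ x ⁆) xs
  xs∉p∪⁅x⁆ = All.zipWith (λ (y∉p , x≢y) → x∉p∪⁅y⁆ y∉p (x≢y ∘ ≡.sym)) (xs∉p , x∉xs)
  count : ∣ p ∪ ⁅ x ⁆ ∣ + length xs ≡ ∣ p ∣ + suc (length xs)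
  count = ≡.trans (cong (_+ length xs) (∣p∪⁅x⁆∣≡suc∣p∣ x∉p)) (≡.sym (+-suc ∣ p ∣ (length xs)))

unique⇒length≤n : {xs : List (Fin n)} → Unique xs → length xs ≤ n
unique⇒length≤n {n} {xs} u =
  subst (λ k → k + length xs ≤ n) (∣⊥∣≡0 n) (∣p∣+length≤n ∅ (All.tabulate λ _ → ∉⊥) u)

∈++-unique⇒∉ : {A : Set} {x : A} {xs ys : List A} → x ∈ₗ xs → Unique (xs ++ ys) → All (x ≢_) ys
∈++-unique⇒∉ {xs = _ ∷ xs} (here refl) (x∉ ∷ _) = ++⁻ʳ xs x∉
∈++-unique⇒∉ (there x∈xs) (_ ∷ u) = ∈++-unique⇒∉ x∈xs u

exchange-< : ∀ {a b c d m} → a < b → b + c ≤ m → a + d ≡ m → c < d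
exchange-< {a} {b} {c} {d} {m} a<b b+c≤m a+d≡m = +-cancelˡ-< a c d (begin-strict
  a + c  <⟨ +-monoˡ-< c a<b ⟩
  b + c  ≤⟨ b+c≤m ⟩
  m      ≡⟨ ≡.sym a+d≡m ⟩
  a + d  ∎)
  where open ≤-Reasoning

module _ (G : Graph n) where

  open import Data.List.Membership.DecPropositional (_≟_ {n}) using () renaming (_∈?_ to _∈ₗ?_)

  infix 4 _∼_ _∼?_

  _∼_ : Fin n → Fin n → Set
  _∼_ = Adj G

  _∼?_ : ∀ x y → Dec (x ∼ y)
  x ∼? y = adj G x y ≟ᵇ true

  ∼-sym : ∀ {x y} → x ∼ y → y ∼ x
  ∼-sym {x} {y} = ≡.trans (Graph.sym G y x)

  ∼-irrefl : ∀ {x} → ¬ x ∼ x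
  ∼-irrefl {x} x∼x with ≡.trans (≡.sym x∼x) (irrefl G x)
  ... | ()

  outside-vertex : ∀ {S a b c} → IsDissociation G S → a ∼ b → b ∼ c → a ≢ c →
                   Σ[ w ∈ Fin n ] w ∉ S × w ∈ₗ a ∷ b ∷ c ∷ []
  outside-vertex {S} {a} {b} {c} dS ab bc a≢c with a ∈? S | b ∈? S | c ∈? S
  ... | no a∉S  | _       | _       = a , a∉S , here refl
  ... | yes _   | no b∉S  | _       = b , b∉S , there (here refl)
  ... | yes _   | yes _   | no c∉S  = c , c∉S , there (there (here refl))
  ... | yes a∈S | yes b∈S | yes c∈S = ⊥-elim (a≢c (dS b a c b∈S a∈S c∈S (∼-sym ab) bc))

  transversal : ∀ {S M} → IsDissociation G S → Is3Matching G M →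
                Σ[ xs ∈ List (Fin n) ] length xs ≡ length M × All (_∉ S) xs × Unique xs × xs ⊆ₗ vertices M
  transversal {M = []} _ _ = [] , refl , [] , [] , λ ()
  transversal {M = (a , b , c) ∷ M} dS ((ab , bc) ∷ paths , u@((_ ∷ a≢c ∷ _) ∷ _))
    with outside-vertex dS ab bc a≢c | transversal dS (paths , drop⁺ 3 u)
  ... | w , w∉S , w∈abc | xs , len , xs∉S , xs-unique , xs⊆M =
    w ∷ xs , cong suc len , w∉S ∷ xs∉S , anti-mono xs⊆M (∈++-unique⇒∉ w∈abc u) ∷ xs-unique , w∷xs⊆
    where
    w∷xs⊆ : w ∷ xs ⊆ₗ vertices ((a , b , c) ∷ M)
    w∷xs⊆ (here refl) = ∈-++⁺ˡ w∈abc
    w∷xs⊆ (there t∈xs) = ∈-++⁺ʳ (a ∷ b ∷ c ∷ []) (xs⊆M t∈xs)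

  ∣S∣+∣M∣≤n : ∀ {S M} → IsDissociation G S → Is3Matching G M → ∣ S ∣ + length M ≤ n
  ∣S∣+∣M∣≤n {S} dS mM with transversal dS mM
  ... | xs , len , xs∉S , xs-unique , _ = subst (λ k → ∣ S ∣ + k ≤ n) len (∣p∣+length≤n S xs∉S xs-unique)

  Centre : Subset n → Fin n → Set
  Centre A x = Σ[ y ∈ Fin n ] Σ[ z ∈ Fin n ] y ∈ A × z ∈ A × x ∼ y × x ∼ z × y ≢ z

  End : Subset n → Fin n → Set
  End A x = Σ[ y ∈ Fin n ] Σ[ z ∈ Fin n ] y ∈ A × z ∈ A × x ∼ y × y ∼ z × z ≢ x

  OnP3 : Subset n → Fin n → Set
  OnP3 A x = Centre A x ⊎ End A x

  centre? : ∀ A x → Dec (Centre A x)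
  centre? A x = any? λ y → any? λ z → y ∈? A ×-dec z ∈? A ×-dec x ∼? y ×-dec x ∼? z ×-dec ¬? (y ≟ z)

  onP3? : ∀ A x → Dec (OnP3 A x)
  onP3? A x = centre? A x ⊎-dec
    any? λ y → any? λ z → y ∈? A ×-dec z ∈? A ×-dec x ∼? y ×-dec y ∼? z ×-dec ¬? (z ≟ x)

  no-neighbour⇒¬OnP3 : ∀ {A v} → (∀ {y} → y ∈ A → ¬ v ∼ y) → ¬ OnP3 A v
  no-neighbour⇒¬OnP3 none (inj₁ (_ , _ , y∈A , _ , vy , _)) = none y∈A vy
  no-neighbour⇒¬OnP3 none (inj₂ (_ , _ , y∈A , _ , vy , _)) = none y∈A vy

  vertex⇒OnP3 : ∀ {A M t} → Is3Matching G M → All (_∈ A) (vertices M) → t ∈ₗ vertices M → OnP3 A t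
  vertex⇒OnP3 {M = (a , b , c) ∷ M} ((ab , bc) ∷ paths , u@((_ ∷ a≢c ∷ _) ∷ _))
              (a∈A ∷ b∈A ∷ c∈A ∷ M⊆A) t∈ with t∈
  ... | here refl = inj₂ (b , c , b∈A , c∈A , ab , bc , a≢c ∘ ≡.sym)
  ... | there (here refl) = inj₁ (a , c , a∈A , c∈A , ∼-sym ab , bc , a≢c)
  ... | there (there (here refl)) = inj₂ (b , a , b∈A , a∈A , ∼-sym bc , ∼-sym ab , a≢c)
  ... | there (there (there t∈M)) = vertex⇒OnP3 (paths , drop⁺ 3 u) M⊆A t∈M

  ∪⁅⁆-dissociation : ∀ {A S x} → IsDissociation G S → S ∪ ⁅ x ⁆ ⊆ A → ¬ OnP3 A x →
                     IsDissociation G (S ∪ ⁅ x ⁆)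
  ∪⁅⁆-dissociation dS inA x∉P3 v a b v∈ a∈ b∈ va vb with a ≟ b
  ... | yes a≡b = a≡b
  ... | no a≢b with x∈p∪⁅y⁆⁻ v∈ | x∈p∪⁅y⁆⁻ a∈ | x∈p∪⁅y⁆⁻ b∈
  ...   | inj₂ refl | _ | _ = ⊥-elim (x∉P3 (inj₁ (a , b , inA a∈ , inA b∈ , va , vb , a≢b)))
  ...   | inj₁ _ | inj₂ refl | _ = ⊥-elim (x∉P3 (inj₂ (v , b , inA v∈ , inA b∈ , ∼-sym va , vb , a≢b ∘ ≡.sym)))
  ...   | inj₁ _ | inj₁ _ | inj₂ refl = ⊥-elim (x∉P3 (inj₂ (v , a , inA v∈ , inA a∈ , ∼-sym vb , va , a≢b)))
  ...   | inj₁ v∈S | inj₁ a∈S | inj₁ b∈S = dS v a b v∈S a∈S b∈S va vb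

  -- A pendant 3-path a–b–c of G[A] can be appended to every 3-matching of
  -- G[A - x], since its vertices other than x lie on no 3-path there.
  Detached : Subset n → Fin n → Fin n → Set
  Detached A x w = w ≡ x ⊎ ¬ OnP3 (A - x) w

  record Pendant3Path (A : Subset n) : Set where
    field
      x a b c : Fin n
      x∈A : x ∈ A
      a∈A : a ∈ A
      b∈A : b ∈ A
      c∈A : c ∈ A
      a∼b : a ∼ b
      b∼c : b ∼ c
      a≢c : a ≢ c
      a-detached : Detached A x a
      b-detached : Detached A x b
      c-detached : Detached A x c

  record TightPair (A : Subset n) : Set where
    field
      S : Subset n
      M : List (Fin n × Fin n × Fin n)
      dissociation : IsDissociation G S
      matching : Is3Matching G M
      S⊆A : S ⊆ A
      M⊆A : All (_∈ A) (vertices M)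
      tight : ∣ S ∣ + length M ≡ ∣ A ∣

  emptyPair : ∀ {A} → A ≡ ∅ → TightPair A
  emptyPair {A} refl = record
    { S = ∅ ; M = [] ; dissociation = λ _ _ _ v∈∅ → ⊥-elim (∉⊥ v∈∅) ; matching = [] , []
    ; S⊆A = ⊆-min A ; M⊆A = [] ; tight = +-identityʳ _ }

  addIsolated : ∀ {A x} → x ∈ A → ¬ OnP3 A x → TightPair (A - x) → TightPair A
  addIsolated {A} {x} x∈A x∉P3 P = record
    { S = S ∪ ⁅ x ⁆ ; M = M
    ; dissociation = ∪⁅⁆-dissociation dissociation S∪⁅x⁆⊆A x∉P3
    ; matching = matching
    ; S⊆A = S∪⁅x⁆⊆A
    ; M⊆A = All.map (p─q⊆p A ⁅ x ⁆) M⊆A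
    ; tight = begin
        ∣ S ∪ ⁅ x ⁆ ∣ + length M  ≡⟨ cong (_+ length M) (∣p∪⁅x⁆∣≡suc∣p∣ (x∉p-x A x ∘ S⊆A)) ⟩
        suc (∣ S ∣ + length M)    ≡⟨ cong suc tight ⟩
        suc ∣ A - x ∣             ≡⟨ suc∣p-x∣≡∣p∣ x∈A ⟩
        ∣ A ∣                     ∎ }
    where
    open TightPair P
    open ≡.≡-Reasoning
    S∪⁅x⁆⊆A : S ∪ ⁅ x ⁆ ⊆ A
    S∪⁅x⁆⊆A = p∪⁅x⁆⊆q (⊆-trans S⊆A (p─q⊆p A ⁅ x ⁆)) x∈A

  addPendant : ∀ {A} (P : Pendant3Path A) → TightPair (A - Pendant3Path.x P) → TightPair A
  addPendant {A} P Q = record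
    { S = S ; M = (a , b , c) ∷ M
    ; dissociation = dissociation
    ; matching = (a∼b , b∼c) ∷ paths
               , (a≢b ∷ a≢c ∷ avoids a-detached) ∷ (b≢c ∷ avoids b-detached) ∷ avoids c-detached ∷ M-unique
    ; S⊆A = ⊆-trans S⊆A (p─q⊆p A ⁅ x ⁆)
    ; M⊆A = a∈A ∷ b∈A ∷ c∈A ∷ All.map (p─q⊆p A ⁅ x ⁆) M⊆A
    ; tight = begin
        ∣ S ∣ + suc (length M)  ≡⟨ +-suc ∣ S ∣ (length M) ⟩
        suc (∣ S ∣ + length M)  ≡⟨ cong suc tight ⟩
        suc ∣ A - x ∣           ≡⟨ suc∣p-x∣≡∣p∣ x∈A ⟩
        ∣ A ∣                   ∎ }
    where
    open Pendant3Path P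
    open TightPair Q
    open ≡.≡-Reasoning
    paths : All (Is3Path G) M
    paths = proj₁ matching
    M-unique : Unique (vertices M)
    M-unique = proj₂ matching
    a≢b : a ≢ b
    a≢b refl = ∼-irrefl a∼b
    b≢c : b ≢ c
    b≢c refl = ∼-irrefl b∼c
    avoids : ∀ {w} → Detached A x w → All (w ≢_) (vertices M)
    avoids (inj₁ refl) = All.map (λ t∈ x≡t → x∉p-x A x (subst (_∈ A - x) (≡.sym x≡t) t∈)) M⊆A
    avoids (inj₂ w∉P3) = All.tabulate λ t∈M w≡t →
      w∉P3 (subst (OnP3 (A - x)) (≡.sym w≡t) (vertex⇒OnP3 matching M⊆A t∈M))

  SoleNeighbour : Subset n → Fin n → Fin n → Set
  SoleNeighbour A v p = ∀ {t} → t ∈ A → v ∼ t → t ≡ p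

  sole⇒¬OnP3-without : ∀ {A v p} → SoleNeighbour A v p → ¬ OnP3 (A - p) v
  sole⇒¬OnP3-without {A} {v} {p} sole = no-neighbour⇒¬OnP3 λ y∈ vy →
    x∉p-x A p (subst (_∈ A - p) (sole (p─q⊆p A ⁅ p ⁆ y∈) vy) y∈)

  isolated-edge⇒¬OnP3 : ∀ {A v p} → SoleNeighbour A v p → SoleNeighbour A p v → ¬ OnP3 A v
  isolated-edge⇒¬OnP3 v-sole p-sole (inj₁ (_ , _ , y∈ , z∈ , vy , vz , y≢z)) =
    y≢z (≡.trans (v-sole y∈ vy) (≡.sym (v-sole z∈ vz)))
  isolated-edge⇒¬OnP3 v-sole p-sole (inj₂ (_ , _ , y∈ , z∈ , vy , yz , z≢v))
    with v-sole y∈ vy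
  ... | refl = z≢v (p-sole z∈ yz)

  cherry⇒pendant : ∀ {A p v w} → p ∈ A → v ∈ A → w ∈ A → p ∼ v → p ∼ w → v ≢ w →
                   SoleNeighbour A v p → SoleNeighbour A w p → Pendant3Path A
  cherry⇒pendant {p = p} {v} {w} p∈A v∈A w∈A pv pw v≢w v-sole w-sole = record
    { x = p ; a = v ; b = p ; c = w ; x∈A = p∈A ; a∈A = v∈A ; b∈A = p∈A ; c∈A = w∈A
    ; a∼b = ∼-sym pv ; b∼c = pw ; a≢c = v≢w
    ; a-detached = inj₂ (sole⇒¬OnP3-without v-sole) ; b-detached = inj₁ refl
    ; c-detached = inj₂ (sole⇒¬OnP3-without w-sole) }

  -- Removing g leaves v–p as an isolated edge of G[A - g].
  leaf-stem⇒pendant : ∀ {A v p g} → v ∈ A → p ∈ A → g ∈ A → v ∼ p → p ∼ g → v ≢ g →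
                      SoleNeighbour A v p → (∀ {t} → t ∈ A → p ∼ t → t ≡ v ⊎ t ≡ g) → Pendant3Path A
  leaf-stem⇒pendant {A} {v} {p} {g} v∈A p∈A g∈A vp pg v≢g v-sole p-nbrs = record
    { x = g ; a = v ; b = p ; c = g ; x∈A = g∈A ; a∈A = v∈A ; b∈A = p∈A ; c∈A = g∈A
    ; a∼b = vp ; b∼c = pg ; a≢c = v≢g
    ; a-detached = inj₂ (isolated-edge⇒¬OnP3 v-sole′ p-sole′)
    ; b-detached = inj₂ (isolated-edge⇒¬OnP3 p-sole′ v-sole′)
    ; c-detached = inj₁ refl }
    where
    v-sole′ : SoleNeighbour (A - g) v p
    v-sole′ t∈ = v-sole (p─q⊆p A ⁅ g ⁆ t∈)
    p-sole′ : SoleNeighbour (A - g) p v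
    p-sole′ t∈ pt with p-nbrs (p─q⊆p A ⁅ g ⁆ t∈) pt
    ... | inj₁ t≡v  = t≡v
    ... | inj₂ refl = ⊥-elim (x∉p-x A g t∈)

  leafy-centre⇒pendant : ∀ {A u y} → u ∈ A → Centre A u →
                         (∀ {z} → z ∈ A → u ∼ z → z ≢ y → SoleNeighbour A z u) → Pendant3Path A
  leafy-centre⇒pendant {A} {u} {y} u∈A (y₁ , y₂ , y₁∈A , y₂∈A , uy₁ , uy₂ , y₁≢y₂) leaf =
    pendant-at neighbour≢y
    where
    neighbour≢y : Σ[ z ∈ Fin n ] z ∈ A × u ∼ z × z ≢ y
    neighbour≢y with y₁ ≟ y
    ... | yes refl = y₂ , y₂∈A , uy₂ , y₁≢y₂ ∘ ≡.sym
    ... | no y₁≢y  = y₁ , y₁∈A , uy₁ , y₁≢y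
    pendant-at : Σ[ z ∈ Fin n ] z ∈ A × u ∼ z × z ≢ y → Pendant3Path A
    pendant-at (z , z∈A , uz , z≢y)
      with any? (λ w → w ∈? A ×-dec u ∼? w ×-dec ¬? (w ≟ y) ×-dec ¬? (w ≟ z))
    ... | yes (w , w∈A , uw , w≢y , w≢z) =
      cherry⇒pendant u∈A z∈A w∈A uz uw (w≢z ∘ ≡.sym) (leaf z∈A uz z≢y) (leaf w∈A uw w≢y)
    ... | no none = leaf-stem⇒pendant z∈A u∈A y∈A (∼-sym uz) uy z≢y (leaf z∈A uz z≢y) u-nbrs
      where
      u-nbrs : ∀ {t} → t ∈ A → u ∼ t → t ≡ z ⊎ t ≡ y
      u-nbrs {t} t∈A ut with t ≟ y | t ≟ z
      ... | yes t≡y | _       = inj₂ t≡y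
      ... | no _    | yes t≡z = inj₁ t≡z
      ... | no t≢y  | no t≢z  = ⊥-elim (none (t , t∈A , ut , t≢y , t≢z))
      y-neighbour : y ∈ A × u ∼ y
      y-neighbour with u-nbrs y₁∈A uy₁ | u-nbrs y₂∈A uy₂
      ... | inj₂ refl | _         = y₁∈A , uy₁
      ... | inj₁ _    | inj₂ refl = y₂∈A , uy₂
      ... | inj₁ y₁≡z | inj₁ y₂≡z = ⊥-elim (y₁≢y₂ (≡.trans y₁≡z (≡.sym y₂≡z)))
      y∈A : y ∈ A
      y∈A = proj₁ y-neighbour
      uy : u ∼ y
      uy = proj₂ y-neighbour

  pendant-or-centre : ∀ {A u} → u ∈ A → Centre A u → (y : Fin n) →
                      Pendant3Path A ⊎ Σ[ z ∈ Fin n ] z ∈ A × u ∼ z × z ≢ y × Centre A z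
  pendant-or-centre {A} {u} u∈A cu y
    with any? (λ z → z ∈? A ×-dec u ∼? z ×-dec ¬? (z ≟ y) ×-dec centre? A z)
  ... | yes found = inj₂ found
  ... | no none = inj₁ (leafy-centre⇒pendant u∈A cu leaf)
    where
    leaf : ∀ {z} → z ∈ A → u ∼ z → z ≢ y → SoleNeighbour A z u
    leaf {z} z∈A uz z≢y {t} t∈A zt with t ≟ u
    ... | yes t≡u = t≡u
    ... | no t≢u  =
      ⊥-elim (none (z , z∈A , uz , z≢y , (u , t , u∈A , t∈A , ∼-sym uz , zt , t≢u ∘ ≡.sym)))

  walk-prefix : ∀ {x vs l z} → Walk G x vs l → Unique vs → z ∈ₗ vs →
                Σ[ ps ∈ List (Fin n) ] Walk G x (x ∷ ps) z × Unique (x ∷ ps) × x ∷ ps ⊆ₗ vs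
  walk-prefix one _ (here refl) = [] , one , [] ∷ [] , λ x∈ → x∈
  walk-prefix (cons _ _) _ (here refl) = [] , one , [] ∷ [] , λ { (here refl) → here refl }
  walk-prefix (cons xy w) (x∉ ∷ u) (there z∈) with walk-prefix w u z∈
  ... | ps , w′ , u′ , ps⊆ =
    _ ∷ ps , cons xy w′ , anti-mono ps⊆ x∉ ∷ u′ ,
    λ { (here refl) → here refl ; (there t∈) → there (ps⊆ t∈) }

  previous : ∀ {h vs l} → Walk G h vs l → Fin n
  previous {h} one = h
  previous (cons {y = s} _ _) = s

  closing-edge⇒cycle : ∀ {h vs l z} (w : Walk G h vs l) → Unique vs → h ∼ z → z ≢ previous w → z ∈ₗ vs →
                       HasCycle G
  closing-edge⇒cycle one _ hz _ (here refl) = ⊥-elim (∼-irrefl hz)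
  closing-edge⇒cycle (cons _ _) _ hz _ (here refl) = ⊥-elim (∼-irrefl hz)
  closing-edge⇒cycle (cons hs w) (h∉ ∷ u) hz z≢s (there z∈) with walk-prefix w u z∈
  ... | [] , one , _ , _ = ⊥-elim (z≢s refl)
  ... | _ ∷ _ , w′ , u′ , ps⊆ =
    _ , _ , _ , cons hs w′ , anti-mono ps⊆ h∉ ∷ u′ , s≤s (s≤s (s≤s z≤n)) , ∼-sym hz

  -- The walk grows at its head through centres of 3-paths; acyclicity keeps
  -- it a path, so within n steps a pendant 3-path appears.
  pendant-from-walk : Acyclic G → ∀ {A} fuel {h vs l} (w : Walk G h vs l) → Unique vs →
                      length vs + fuel ≡ suc n → h ∈ A → Centre A h → Pendant3Path A
  pendant-from-walk _ zero {vs = vs} _ u len _ _ =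
    ⊥-elim (n≮n n (subst (_≤ n) (≡.trans (≡.sym (+-identityʳ (length vs))) len) (unique⇒length≤n u)))
  pendant-from-walk acyclic (suc fuel) {vs = vs} w u len h∈A ch with pendant-or-centre h∈A ch (previous w)
  ... | inj₁ P = P
  ... | inj₂ (z , z∈A , hz , z≢prev , cz) with z ∈ₗ? vs
  ...   | yes z∈vs = ⊥-elim (acyclic (closing-edge⇒cycle w u hz z≢prev z∈vs))
  ...   | no z∉vs = pendant-from-walk acyclic fuel (cons (∼-sym hz) w) (¬Any⇒All¬ vs z∉vs ∷ u)
                      (≡.trans (≡.sym (+-suc (length vs) fuel)) len) z∈A cz

  pendant3Path : Acyclic G → ∀ {A x} → x ∈ A → OnP3 A x → Pendant3Path A
  pendant3Path acyclic x∈A (inj₁ cx) = pendant-from-walk acyclic n one ([] ∷ []) refl x∈A cx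
  pendant3Path acyclic {x = x} x∈A (inj₂ (y , z , y∈A , z∈A , xy , yz , z≢x)) =
    pendant-from-walk acyclic n one ([] ∷ []) refl y∈A (x , z , x∈A , z∈A , ∼-sym xy , yz , z≢x ∘ ≡.sym)

  tightPair : Acyclic G → (A : Subset n) → Acc _⊂_ A → TightPair A
  tightPair acyclic A (acc smaller) with nonempty? A
  ... | no empty = emptyPair (Empty-unique empty)
  ... | yes (x , x∈A) with onP3? A x
  ...   | no x∉P3 = addIsolated x∈A x∉P3 (tightPair acyclic (A - x) (smaller (x∈p⇒p-x⊂p x∈A)))
  ...   | yes x∈P3 = let P = pendant3Path acyclic x∈A x∈P3 in
    addPendant P (tightPair acyclic (A - Pendant3Path.x P) (smaller (x∈p⇒p-x⊂p (Pendant3Path.x∈A P))))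

  acyclic⇒∣S∣+∣M∣≡n : Acyclic G → Σ[ S ∈ Subset n ] Σ[ M ∈ List (Fin n × Fin n × Fin n) ]
                       IsDissociation G S × Is3Matching G M × ∣ S ∣ + length M ≡ n
  acyclic⇒∣S∣+∣M∣≡n acyclic = S , M , dissociation , matching , ≡.trans tight (∣⊤∣≡n n)
    where open TightPair (tightPair acyclic full (⊂-wellFounded full))

acyclic-mono : {G H : Graph n} → (∀ {x y} → Adj H x y → Adj G x y) → Acyclic G → Acyclic H
acyclic-mono {G = G} {H} H⊆G acyclic (x , y , vs , w , u , len , yx) =
  acyclic (x , y , vs , walk w , u , len , H⊆G yx)
  where
  walk : ∀ {a vs b} → Walk H a vs b → Walk G a vs b
  walk one = one
  walk (cons e w) = cons (H⊆G e) (walk w)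

deleteEdge-⊆ : (G : Graph n) (u v : Fin n) {x y : Fin n} → Adj (deleteEdge G u v) x y → Adj G x y
deleteEdge-⊆ G u v {x} {y} e with adj G x y
... | true  = refl
... | false = e

corollary3p4 : ∀ {n} (T : Graph n) → IsTree T → ∀ (u v : Fin n) → Adj T u v →
                 (α₃-critical T u v ⇔ μ₃-critical T u v)
corollary3p4 {n} T (_ , acyclic) u v _ = mk⇔ to from
  where
  T-uv : Graph n
  T-uv = deleteEdge T u v
  to : α₃-critical T u v → μ₃-critical T u v
  to (S , dS , S-larger) with acyclic⇒∣S∣+∣M∣≡n T acyclic
  ... | S₀ , M₀ , dS₀ , mM₀ , tight₀ =
    M₀ , mM₀ , λ M mM → exchange-< (S-larger S₀ dS₀) (∣S∣+∣M∣≤n T-uv dS mM) tight₀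
  from : μ₃-critical T u v → α₃-critical T u v
  from (M , mM , M-larger) with acyclic⇒∣S∣+∣M∣≡n T-uv (acyclic-mono (deleteEdge-⊆ T u v) acyclic)
  ... | S₀ , M₀ , dS₀ , mM₀ , tight₀ =
    S₀ , dS₀ , λ S dS → exchange-< (M-larger M₀ mM₀)
      (≤-trans (≤-reflexive (+-comm (length M) ∣ S ∣)) (∣S∣+∣M∣≤n T dS mM))
      (≡.trans (+-comm (length M₀) ∣ S₀ ∣) tight₀)
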